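{- Let $\mathcal F$ be a finite simplicial complex of dimension $d$ with extended $f$-vector $(f_{ -1},f_0,\ldots,f_d)$. Then $\mathcal F$ satisfies the Dehn–Sommerville equations, i.e. $f_{k-1}=\sum_{i=k}^{d+1}(-1)^{d+1-i}\binom{i}{k}f_{i-1}$ for all $k=0,\ldots,d+1$, if and only if the column vector $[f_d,f_{d-1},\ldots,f_0,f_{ -1},0,0,\ldots]^T$ is an eigenvector of eigenvalue $1$ of the matrix $T\big(-(1+x)^{d+2}\mid -(1+x)\big)$.
   Context: For formal power series $\alpha,\omega\in\mathbb C[[x]]$ with $\alpha(0)\ne0$, $\omega(0)\neq0$, $T(\alpha\mid\omega)$ denotes the infinite lower triangular matrix $(d_{ij})_{i,j\ge0}$ with $d_{ij}=[x^i]\,x^j\alpha(x)/\omega(x)^{j+1}$. For a simplicial complex, $f_k$ ($0\le k\le d$) is the number of $k$-dimensional faces and $f_{ -1}=1$. -}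

module Defs where

open import Data.Nat as ℕ using (ℕ; zero; suc; _≤_; _<ᵇ_)
open import Data.Integer as ℤ using (ℤ; +_; _+_; _*_; -_)
open import Data.Bool using (Bool; true; false; if_then_else_; _∧_)
open import Data.List as List using (List; []; _∷_; _++_; _∷ʳ_)
open import Data.Vec using ([]; _∷_)
open import Data.Fin.Subset using (Subset; Side; inside; outside; _⊆_; ∣_∣; ⊥)
open import Data.Product using (Σ; _×_)
open import Relation.Binary.PropositionalEquality using (_≡_)
open import Data.Nat.Combinatorics using (_C_)

sumTo : ℕ → (ℕ → ℤ) → ℤ
sumTo zero    g = + 0
sumTo (suc n) g = sumTo n g + g n

sgn : ℕ → ℤ
sgn zero    = + 1
sgn (suc m) = - sgn m

-- Formal power series with integer coefficients: n ↦ [x^n]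

PS : Set
PS = ℕ → ℤ

_·_ : PS → PS → PS
(a · b) n = sumTo (suc n) (λ k → a k * b (n ℕ.∸ k))

_^ₚ_ : PS → ℕ → PS
(a ^ₚ zero) zero    = + 1
(a ^ₚ zero) (suc n) = + 0
a ^ₚ suc m = a · (a ^ₚ m)

shift : ℕ → PS → PS
shift j a n = if n <ᵇ j then + 0 else a (n ℕ.∸ j)

negₚ : PS → PS
negₚ a n = - a n

1+x : PS
1+x zero          = + 1
1+x (suc zero)    = + 1
1+x (suc (suc n)) = + 0

nth : List ℤ → ℕ → ℤ
nth []       _       = + 0
nth (x ∷ xs) zero    = x
nth (x ∷ xs) (suc n) = nth xs n

-- Multiplicative inverse of a power series ω whose constant term is a
-- unit of ℤ, i.e. ω 0 ∈ {1, -1} (then ω 0 is its own inverse).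
-- invList ω n = [ b_0 , … , b_n ] with b_0 = ω(0)⁻¹ and
-- b_m = - ω(0)⁻¹ * Σ_{k=1}^{m} ω_k b_{m-k}.
invList : PS → ℕ → List ℤ
invList ω zero    = ω 0 ∷ []
invList ω (suc m) =
  let p = invList ω m in
  p ∷ʳ (- (ω 0 * sumTo (suc m) (λ t → ω (suc t) * nth p (m ℕ.∸ t))))

inv : PS → PS
inv ω n = nth (invList ω n) n

-- Riordan-type matrix T(α ∣ ω): entry (i,j) = [x^i] x^j α(x) / ω(x)^{j+1}
-- (valid here for ω(0) ∈ {1,-1}, which covers the statement's ω = -(1+x))
T : PS → PS → ℕ → ℕ → ℤ
T α ω i j = shift j (α · (inv ω ^ₚ suc j)) i

allSubsets : (n : ℕ) → List (Subset n)
allSubsets zero    = [] ∷ []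
allSubsets (suc n) =
  List.map (outside ∷_) (allSubsets n) ++ List.map (inside ∷_) (allSubsets n)

record SimplicialComplex (n : ℕ) : Set where
  field
    face      : Subset n → Bool
    empty∈    : face ⊥ ≡ true
    downClosed : ∀ σ τ → τ ⊆ σ → face σ ≡ true → face τ ≡ true
open SimplicialComplex public

HasDimension : ∀ {n} → SimplicialComplex n → ℕ → Set
HasDimension {n} F d =
  Σ (Subset n) (λ σ → (face F σ ≡ true) × (∣ σ ∣ ≡ suc d))
  × (∀ σ → face F σ ≡ true → ∣ σ ∣ ≤ suc d)

-- number of faces with exactly m vertices; so fe F (k+1) = f_k, fe F 0 = f_{-1}
count : ∀ {A : Set} → (A → Bool) → List A → ℕ
count p []       = 0
count p (x ∷ xs) = if p x then suc (count p xs) else count p xs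

fe : ∀ {n} → SimplicialComplex n → ℕ → ℕ
fe {n} F m = count (λ σ → face F σ ∧ (∣ σ ∣ ℕ.≡ᵇ m)) (allSubsets n)

DehnSommerville : ∀ {n} → SimplicialComplex n → ℕ → Set
DehnSommerville F d =
  ∀ k → k ≤ suc d →
    + fe F k ≡ sumTo (suc (suc d) ℕ.∸ k)
                 (λ t → sgn (suc d ℕ.∸ (k ℕ.+ t)) * + ((k ℕ.+ t) C k) * + fe F (k ℕ.+ t))

fvec : ∀ {n} → SimplicialComplex n → ℕ → ℕ → ℤ
fvec F d r = if suc d <ᵇ r then + 0 else + fe F (suc d ℕ.∸ r)

-- v is an eigenvector of eigenvalue 1 of the lower-triangular matrix M:
-- (M v)_i = Σ_{j ≤ i} M i j v j = v i for every i
-- (the sum is finite since M is lower triangular)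
Eigen1 : (ℕ → ℕ → ℤ) → (ℕ → ℤ) → Set
Eigen1 M v = ∀ i → sumTo (suc i) (λ j → M i j * v j) ≡ v i

Tds : ℕ → ℕ → ℕ → ℤ
Tds d = T (negₚ (1+x ^ₚ suc (suc d))) (negₚ 1+x)

{-# OPTIONS --safe #-}
module Submission where

-- With u = 1/ω = -1/(1+x), consecutive columns α uʲ of T(α ∣ ω) satisfy
-- (1+x)·(α uʲ⁺¹) = -(α uʲ); starting from α = -(1+x)^{d+2} this forces
-- α uʲ = (-1)^{j+1} (1+x)^{d+2-j} for j ≤ d+2, so the (i,j) entry of
-- T(-(1+x)^{d+2} ∣ -(1+x)) is (-1)ʲ C(d+1-j, i-j).  Row i ≤ d+1 of T applied
-- to the f-vector is then, after reindexing j ↦ d+1-j, the right-hand side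
-- of the Dehn–Sommerville equation for k = d+1-i, and rows i > d+1 vanish
-- on both sides.  Hence the two systems of equations coincide one by one.

open import Defs
open import Data.Nat as ℕ using (ℕ; zero; suc; _≤_; _<_; z≤n; s≤s; _<ᵇ_; _≤?_)
open import Data.Nat.Properties as ℕP using (≤-pred; ≤-refl; ≰⇒>)
open import Data.Nat.Combinatorics
  using (_C_; nCk+nC[k+1]≡[n+1]C[k+1]; k>n⇒nCk≡0; nCk≡nC[n∸k])
open import Data.Integer using (ℤ; +_; _+_; _-_; _*_; -_; -1ℤ)
open import Data.Integer.Properties as ℤP using (neg-involutive; -1*i≡-i)
open import Data.Integer.Tactic.RingSolver using (solve-∀)
open import Data.Bool using (if_then_else_)
open import Data.List using (List; []; _∷_; _∷ʳ_; length)
open import Data.List.Properties using (length-++)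
open import Data.Product using (_×_; _,_)
open import Data.Sum using (inj₁; inj₂)
open import Relation.Nullary using (yes; no)
open import Relation.Binary.PropositionalEquality
open ≡-Reasoning

sumTo-cong : ∀ n {g h : ℕ → ℤ} → (∀ k → k < n → g k ≡ h k) → sumTo n g ≡ sumTo n h
sumTo-cong zero    eq = refl
sumTo-cong (suc n) eq =
  cong₂ _+_ (sumTo-cong n (λ k k<n → eq k (ℕP.m<n⇒m<1+n k<n))) (eq n ≤-refl)

sumTo-≡0 : ∀ n {g : ℕ → ℤ} → (∀ k → k < n → g k ≡ + 0) → sumTo n g ≡ + 0
sumTo-≡0 n eq = trans (sumTo-cong n eq) (sumTo-const0 n)
  where
  sumTo-const0 : ∀ n → sumTo n (λ _ → + 0) ≡ + 0
  sumTo-const0 zero    = refl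
  sumTo-const0 (suc n) = cong (_+ + 0) (sumTo-const0 n)

sumTo-suc-front : ∀ n (g : ℕ → ℤ) → sumTo (suc n) g ≡ g 0 + sumTo n (λ k → g (suc k))
sumTo-suc-front zero    g = ℤP.+-comm (+ 0) (g 0)
sumTo-suc-front (suc n) g = begin
  sumTo (suc n) g + g (suc n)                    ≡⟨ cong (_+ g (suc n)) (sumTo-suc-front n g) ⟩
  g 0 + sumTo n (λ k → g (suc k)) + g (suc n)    ≡⟨ ℤP.+-assoc (g 0) _ _ ⟩
  g 0 + (sumTo n (λ k → g (suc k)) + g (suc n))  ∎

sumTo-neg : ∀ n (g : ℕ → ℤ) → sumTo n (λ k → - g k) ≡ - sumTo n g
sumTo-neg zero    g = refl
sumTo-neg (suc n) g =
  trans (cong (_+ - g n) (sumTo-neg n g)) (sym (ℤP.neg-distrib-+ (sumTo n g) (g n)))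

sumTo-+ : ∀ n (g h : ℕ → ℤ) → sumTo n (λ k → g k + h k) ≡ sumTo n g + sumTo n h
sumTo-+ zero    g h = refl
sumTo-+ (suc n) g h =
  trans (cong (_+ (g n + h n)) (sumTo-+ n g h)) (interchange (sumTo n g) (sumTo n h) (g n) (h n))
  where
  interchange : ∀ a b c d → (a + b) + (c + d) ≡ (a + c) + (b + d)
  interchange = solve-∀

sumTo-reverse : ∀ n (g : ℕ → ℤ) → sumTo n g ≡ sumTo n (λ t → g (n ℕ.∸ suc t))
sumTo-reverse zero    g = refl
sumTo-reverse (suc n) g = begin
  sumTo n g + g n                          ≡⟨ cong (_+ g n) (sumTo-reverse n g) ⟩
  sumTo n (λ t → g (n ℕ.∸ suc t)) + g n    ≡⟨ ℤP.+-comm _ (g n) ⟩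
  g n + sumTo n (λ t → g (n ℕ.∸ suc t))    ≡⟨ sumTo-suc-front n (λ t → g (n ℕ.∸ t)) ⟨
  sumTo (suc n) (λ t → g (n ℕ.∸ t))        ∎

if-<ᵇ-< : ∀ {A : Set} {m n} {x y : A} → m < n → (if m <ᵇ n then x else y) ≡ x
if-<ᵇ-< {m = zero}  (s≤s _)   = refl
if-<ᵇ-< {m = suc m} (s≤s m<n) = if-<ᵇ-< m<n

if-<ᵇ-≥ : ∀ {A : Set} {m n} {x y : A} → n ≤ m → (if m <ᵇ n then x else y) ≡ y
if-<ᵇ-≥ z≤n       = refl
if-<ᵇ-≥ (s≤s n≤m) = if-<ᵇ-≥ n≤m

shift-≥ : ∀ {i j} (a : PS) → j ≤ i → shift j a i ≡ a (i ℕ.∸ j)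
shift-≥ a = if-<ᵇ-≥

·-^ₚ0 : ∀ (a c : PS) → a · (c ^ₚ 0) ≗ a
·-^ₚ0 a c n = begin
  sumTo n (λ k → a k * (c ^ₚ 0) (n ℕ.∸ k)) + a n * (c ^ₚ 0) (n ℕ.∸ n)
    ≡⟨ cong₂ _+_ (sumTo-≡0 n off-diagonal) (cong (λ m → a n * (c ^ₚ 0) m) (ℕP.n∸n≡0 n)) ⟩
  + 0 + a n * + 1
    ≡⟨ trans (ℤP.+-identityˡ _) (ℤP.*-identityʳ (a n)) ⟩
  a n ∎
  where
  off-diagonal : ∀ k → k < n → a k * (c ^ₚ 0) (n ℕ.∸ k) ≡ + 0
  off-diagonal k k<n with n ℕ.∸ k | ℕP.m<n⇒0<n∸m k<n
  ... | suc _ | _ = ℤP.*-zeroʳ (a k)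

1+x·-zero : ∀ (c : PS) → (1+x · c) 0 ≡ c 0
1+x·-zero c = trans (ℤP.+-identityˡ _) (ℤP.*-identityˡ (c 0))

1+x·-suc : ∀ (c : PS) n → (1+x · c) (suc n) ≡ c (suc n) + c n
1+x·-suc c n = begin
  (1+x · c) (suc n)
    ≡⟨ sumTo-suc-front (suc n) _ ⟩
  + 1 * c (suc n) + sumTo (suc n) (λ k → 1+x (suc k) * c (n ℕ.∸ k))
    ≡⟨ cong (_+_ (+ 1 * c (suc n))) (sumTo-suc-front n _) ⟩
  + 1 * c (suc n) + (+ 1 * c n + sumTo n (λ k → + 0 * c (n ℕ.∸ suc k)))
    ≡⟨ cong (λ s → + 1 * c (suc n) + (+ 1 * c n + s)) (sumTo-≡0 n (λ _ _ → refl)) ⟩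
  + 1 * c (suc n) + (+ 1 * c n + + 0)
    ≡⟨ normalise (c (suc n)) (c n) ⟩
  c (suc n) + c n ∎
  where
  normalise : ∀ y z → + 1 * y + (+ 1 * z + + 0) ≡ y + z
  normalise = solve-∀

1+x^-coeff : ∀ m n → (1+x ^ₚ m) n ≡ + (m C n)
1+x^-coeff zero    zero    = refl
1+x^-coeff zero    (suc n) = refl
1+x^-coeff (suc m) zero    = trans (1+x·-zero (1+x ^ₚ m)) (1+x^-coeff m 0)
1+x^-coeff (suc m) (suc n) = begin
  (1+x · (1+x ^ₚ m)) (suc n)         ≡⟨ 1+x·-suc (1+x ^ₚ m) n ⟩
  (1+x ^ₚ m) (suc n) + (1+x ^ₚ m) n  ≡⟨ cong₂ _+_ (1+x^-coeff m (suc n)) (1+x^-coeff m n) ⟩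
  + (m C suc n) + + (m C n)          ≡⟨ ℤP.pos-+ (m C suc n) (m C n) ⟨
  + (m C suc n ℕ.+ m C n)            ≡⟨ cong +_ (ℕP.+-comm (m C suc n) (m C n)) ⟩
  + (m C n ℕ.+ m C suc n)            ≡⟨ cong +_ (nCk+nC[k+1]≡[n+1]C[k+1] m n) ⟩
  + (suc m C suc n)                  ∎

nth-∷ʳ-< : ∀ (p : List ℤ) x {k} → k < length p → nth (p ∷ʳ x) k ≡ nth p k
nth-∷ʳ-< (y ∷ p) x {zero}  _         = refl
nth-∷ʳ-< (y ∷ p) x {suc k} (s≤s k<n) = nth-∷ʳ-< p x k<n

nth-∷ʳ-length : ∀ (p : List ℤ) x → nth (p ∷ʳ x) (length p) ≡ x
nth-∷ʳ-length []      x = refl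
nth-∷ʳ-length (y ∷ p) x = nth-∷ʳ-length p x

length-invList : ∀ ω m → length (invList ω m) ≡ suc m
length-invList ω zero    = refl
length-invList ω (suc m) =
  trans (length-++ (invList ω m)) (trans (cong (ℕ._+ 1) (length-invList ω m)) (ℕP.+-comm (suc m) 1))

nth-invList : ∀ ω {m k} → k ≤ m → nth (invList ω m) k ≡ inv ω k
nth-invList ω {zero}  z≤n = refl
nth-invList ω {suc m} k≤1+m with ℕP.m≤n⇒m<n∨m≡n k≤1+m
... | inj₂ refl = refl
... | inj₁ k<1+m =
  trans (nth-∷ʳ-< (invList ω m) _ (subst (_ <_) (sym (length-invList ω m)) k<1+m))
        (nth-invList ω (≤-pred k<1+m))

inv-suc : ∀ ω m → inv ω (suc m) ≡ - (ω 0 * sumTo (suc m) (λ t → ω (suc t) * inv ω (m ℕ.∸ t)))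
inv-suc ω m = begin
  nth (invList ω m ∷ʳ next (invList ω m)) (suc m)
    ≡⟨ subst (λ l → nth (invList ω m ∷ʳ next (invList ω m)) l ≡ next (invList ω m))
             (length-invList ω m) (nth-∷ʳ-length (invList ω m) _) ⟩
  next (invList ω m)
    ≡⟨ cong (λ s → - (ω 0 * s)) (sumTo-cong (suc m) λ t _ → cong (ω (suc t) *_) (nth-invList ω (ℕP.m∸n≤m m t))) ⟩
  - (ω 0 * sumTo (suc m) (λ t → ω (suc t) * inv ω (m ℕ.∸ t))) ∎
  where
  next : List ℤ → ℤ
  next p = - (ω 0 * sumTo (suc m) (λ t → ω (suc t) * nth p (m ℕ.∸ t)))

u : PS
u = inv (negₚ 1+x)

u-suc : ∀ m → u (suc m) ≡ - u m
u-suc m = begin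
  u (suc m)
    ≡⟨ inv-suc (negₚ 1+x) m ⟩
  - (-1ℤ * sumTo (suc m) (λ t → negₚ 1+x (suc t) * u (m ℕ.∸ t)))
    ≡⟨ cong (λ s → - (-1ℤ * s)) (sumTo-suc-front m _) ⟩
  - (-1ℤ * (-1ℤ * u m + sumTo m (λ t → + 0 * u (m ℕ.∸ suc t))))
    ≡⟨ cong (λ s → - (-1ℤ * (-1ℤ * u m + s))) (sumTo-≡0 m (λ _ _ → refl)) ⟩
  - (-1ℤ * (-1ℤ * u m + + 0))
    ≡⟨ normalise (u m) ⟩
  - u m ∎
  where
  normalise : ∀ y → - (-1ℤ * (-1ℤ * y + + 0)) ≡ - y
  normalise = solve-∀

-- c = -w/(1+x), as the coefficient recurrence of (1+x)·c = -w.
NegQuotient1+x : PS → PS → Set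
NegQuotient1+x w c = (c 0 ≡ - w 0) × (∀ m → c (suc m) ≡ - w (suc m) - c m)

negQuotient-unique : ∀ {w w′ c c′} → NegQuotient1+x w c → NegQuotient1+x w′ c′ → w ≗ w′ → c ≗ c′
negQuotient-unique (c0 , _) (c′0 , _) w≗w′ zero = trans c0 (trans (cong -_ (w≗w′ 0)) (sym c′0))
negQuotient-unique q@(_ , cs) q′@(_ , c′s) w≗w′ (suc m) =
  trans (cs m) (trans (cong₂ (λ x y → - x - y) (w≗w′ (suc m)) (negQuotient-unique q q′ w≗w′ m)) (sym (c′s m)))

negQuotient-u· : ∀ w → NegQuotient1+x w (u · w)
negQuotient-u· w = trans (ℤP.+-identityˡ _) (-1*i≡-i (w 0)) , λ m → begin
  (u · w) (suc m)
    ≡⟨ sumTo-suc-front (suc m) _ ⟩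
  -1ℤ * w (suc m) + sumTo (suc m) (λ k → u (suc k) * w (m ℕ.∸ k))
    ≡⟨ cong₂ _+_ (-1*i≡-i (w (suc m))) (sumTo-cong (suc m) λ k _ → u-suc-* k (w (m ℕ.∸ k))) ⟩
  - w (suc m) + sumTo (suc m) (λ k → - (u k * w (m ℕ.∸ k)))
    ≡⟨ cong (_+_ (- w (suc m))) (sumTo-neg (suc m) _) ⟩
  - w (suc m) - (u · w) m ∎
  where
  u-suc-* : ∀ k y → u (suc k) * y ≡ - (u k * y)
  u-suc-* k y = trans (cong (_* y) (u-suc k)) (sym (ℤP.neg-distribˡ-* (u k) y))

negQuotient-·ˡ : ∀ (a : PS) {w c} → NegQuotient1+x w c → NegQuotient1+x (a · w) (a · c)
negQuotient-·ˡ a {w} {c} (c0 , cs) = trans (cong (λ y → + 0 + a 0 * y) c0) (distrib₀ (a 0) (w 0)) , step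
  where
  distrib₀ : ∀ x y → + 0 + x * - y ≡ - (+ 0 + x * y)
  distrib₀ = solve-∀
  distrib₁ : ∀ x y z → x * (- y - z) ≡ - (x * y) + - (x * z)
  distrib₁ = solve-∀
  regroup : ∀ s t l → - s - t - l ≡ - (s + l) - t
  regroup = solve-∀

  recurrence : ∀ m k → k < suc m →
    a k * c (suc m ℕ.∸ k) ≡ - (a k * w (suc m ℕ.∸ k)) + - (a k * c (m ℕ.∸ k))
  recurrence m k k<1+m rewrite ℕP.+-∸-assoc 1 (≤-pred k<1+m) =
    trans (cong (a k *_) (cs (m ℕ.∸ k))) (distrib₁ (a k) _ _)

  step : ∀ m → (a · c) (suc m) ≡ - (a · w) (suc m) - (a · c) m
  step m = begin
    sumTo (suc m) (λ k → a k * c (suc m ℕ.∸ k)) + a (suc m) * c (m ℕ.∸ m)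
      ≡⟨ cong₂ _+_ (sumTo-cong (suc m) (recurrence m)) (cong (a (suc m) *_) (trans (cong c (ℕP.n∸n≡0 m)) c0)) ⟩
    sumTo (suc m) (λ k → - (a k * w (suc m ℕ.∸ k)) + - (a k * c (m ℕ.∸ k))) + a (suc m) * - w 0
      ≡⟨ cong₂ _+_ (sumTo-+ (suc m) _ _) (sym (ℤP.neg-distribʳ-* (a (suc m)) (w 0))) ⟩
    sumTo (suc m) (λ k → - (a k * w (suc m ℕ.∸ k))) + sumTo (suc m) (λ k → - (a k * c (m ℕ.∸ k)))
      + - (a (suc m) * w 0)
      ≡⟨ cong (_+ - (a (suc m) * w 0)) (cong₂ _+_ (sumTo-neg (suc m) _) (sumTo-neg (suc m) _)) ⟩
    - S - (a · c) m - a (suc m) * w 0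
      ≡⟨ regroup S ((a · c) m) (a (suc m) * w 0) ⟩
    - (S + a (suc m) * w 0) - (a · c) m
      ≡⟨ cong (λ n → - (S + a (suc m) * w n) - (a · c) m) (sym (ℕP.n∸n≡0 m)) ⟩
    - (a · w) (suc m) - (a · c) m ∎
    where
    S : ℤ
    S = sumTo (suc m) (λ k → a k * w (suc m ℕ.∸ k))

signedBinomial : ℤ → ℕ → PS
signedBinomial s m n = s * + (m C n)

negQuotient-signedBinomial : ∀ s m → NegQuotient1+x (signedBinomial s (suc m)) (signedBinomial (- s) m)
negQuotient-signedBinomial s m = sym (ℤP.neg-distribˡ-* s (+ 1)) , λ n → begin
  - s * + (m C suc n)
    ≡⟨ pascal-step s (+ (m C n)) (+ (m C suc n)) ⟩
  - (s * (+ (m C n) + + (m C suc n))) - (- s * + (m C n))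
    ≡⟨ cong (λ x → - (s * x) - (- s * + (m C n))) (sym (ℤP.pos-+ (m C n) (m C suc n))) ⟩
  - (s * + (m C n ℕ.+ m C suc n)) - (- s * + (m C n))
    ≡⟨ cong (λ x → - (s * + x) - (- s * + (m C n))) (nCk+nC[k+1]≡[n+1]C[k+1] m n) ⟩
  - (s * + (suc m C suc n)) - (- s * + (m C n)) ∎
  where
  pascal-step : ∀ s x y → - s * y ≡ - (s * (x + y)) - (- s * x)
  pascal-step = solve-∀

α : ℕ → PS
α d = negₚ (1+x ^ₚ suc (suc d))

α·u^ : ∀ d j → j ≤ suc (suc d) → α d · (u ^ₚ j) ≗ signedBinomial (sgn (suc j)) (suc (suc d) ℕ.∸ j)
α·u^ d zero    _         n = begin
  (α d · (u ^ₚ 0)) n               ≡⟨ ·-^ₚ0 (α d) u n ⟩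
  - (1+x ^ₚ suc (suc d)) n         ≡⟨ cong -_ (1+x^-coeff (suc (suc d)) n) ⟩
  - + (suc (suc d) C n)            ≡⟨ -1*i≡-i _ ⟨
  -1ℤ * + (suc (suc d) C n)        ∎
-- α d · u ^ₚ suc j is α d · (u · u ^ₚ j) by definition, so no associativity of · is needed.
α·u^ d (suc j) (s≤s j≤1+d) =
  negQuotient-unique (negQuotient-·ˡ (α d) {u ^ₚ j} {u ^ₚ suc j} (negQuotient-u· (u ^ₚ j)))
                     next
                     (α·u^ d j (ℕP.m≤n⇒m≤1+n j≤1+d))
  where
  next : NegQuotient1+x (signedBinomial (sgn (suc j)) (suc (suc d) ℕ.∸ j))
                        (signedBinomial (sgn (suc (suc j))) (suc d ℕ.∸ j))
  next = subst (λ m → NegQuotient1+x (signedBinomial (sgn (suc j)) m)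
                                    (signedBinomial (sgn (suc (suc j))) (suc d ℕ.∸ j)))
               (sym (ℕP.+-∸-assoc 1 j≤1+d))
               (negQuotient-signedBinomial (sgn (suc j)) (suc d ℕ.∸ j))

Tds-entry : ∀ d {i j} → j ≤ i → j ≤ suc d → Tds d i j ≡ sgn j * + ((suc d ℕ.∸ j) C (i ℕ.∸ j))
Tds-entry d {i} {j} j≤i j≤1+d = begin
  Tds d i j                                  ≡⟨ shift-≥ (α d · (u ^ₚ suc j)) j≤i ⟩
  (α d · (u ^ₚ suc j)) (i ℕ.∸ j)             ≡⟨ α·u^ d (suc j) (s≤s j≤1+d) (i ℕ.∸ j) ⟩
  - - sgn j * + ((suc d ℕ.∸ j) C (i ℕ.∸ j))  ≡⟨ cong (λ s → s * + ((suc d ℕ.∸ j) C (i ℕ.∸ j)))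
                                                     (neg-involutive (sgn j)) ⟩
  sgn j * + ((suc d ℕ.∸ j) C (i ℕ.∸ j))      ∎

[o∸n]+[n∸m]≡o∸m : ∀ {m n o} → m ≤ n → n ≤ o → (o ℕ.∸ n) ℕ.+ (n ℕ.∸ m) ≡ o ℕ.∸ m
[o∸n]+[n∸m]≡o∸m {m} {n} {o} m≤n n≤o =
  trans (sym (ℕP.+-∸-assoc (o ℕ.∸ n) m≤n)) (cong (ℕ._∸ m) (ℕP.m∸n+n≡m n≤o))

[o∸m]∸[o∸n]≡n∸m : ∀ {m n o} → m ≤ n → n ≤ o → (o ℕ.∸ m) ℕ.∸ (o ℕ.∸ n) ≡ n ℕ.∸ m
[o∸m]∸[o∸n]≡n∸m {m} {n} {o} m≤n n≤o =
  trans (cong (ℕ._∸ (o ℕ.∸ n)) (sym ([o∸n]+[n∸m]≡o∸m m≤n n≤o))) (ℕP.m+n∸m≡n (o ℕ.∸ n) (n ℕ.∸ m))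

module _ {n} (F : SimplicialComplex n) (d : ℕ) where

  rowSum : ℕ → ℤ
  rowSum i = sumTo (suc i) (λ j → Tds d i j * fvec F d j)

  dehnSommervilleTerm : ℕ → ℕ → ℤ
  dehnSommervilleTerm k t = sgn (suc d ℕ.∸ (k ℕ.+ t)) * + ((k ℕ.+ t) C k) * + fe F (k ℕ.+ t)

  dehnSommervilleSum : ℕ → ℤ
  dehnSommervilleSum k = sumTo (suc (suc d) ℕ.∸ k) (dehnSommervilleTerm k)

  fvec-≤ : ∀ {r} → r ≤ suc d → fvec F d r ≡ + fe F (suc d ℕ.∸ r)
  fvec-≤ = if-<ᵇ-≥

  fvec-> : ∀ {r} → suc d < r → fvec F d r ≡ + 0
  fvec-> = if-<ᵇ-<

  rowSum-term : ∀ {i j} → j ≤ i → i ≤ suc d →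
    Tds d i j * fvec F d j ≡ dehnSommervilleTerm (suc d ℕ.∸ i) (i ℕ.∸ j)
  rowSum-term {i} {j} j≤i i≤D = begin
    Tds d i j * fvec F d j
      ≡⟨ cong₂ _*_ (Tds-entry d j≤i j≤D) (fvec-≤ j≤D) ⟩
    sgn j * + ((D ℕ.∸ j) C (i ℕ.∸ j)) * + fe F (D ℕ.∸ j)
      ≡⟨ cong (λ c → sgn j * + c * + fe F (D ℕ.∸ j)) binomial-symmetry ⟩
    sgn j * + ((D ℕ.∸ j) C k) * + fe F (D ℕ.∸ j)
      ≡⟨ cong (λ l → sgn l * + ((D ℕ.∸ j) C k) * + fe F (D ℕ.∸ j)) (sym (ℕP.m∸[m∸n]≡n j≤D)) ⟩
    sgn (D ℕ.∸ (D ℕ.∸ j)) * + ((D ℕ.∸ j) C k) * + fe F (D ℕ.∸ j)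
      ≡⟨ cong (λ m → sgn (D ℕ.∸ m) * + (m C k) * + fe F m) (sym ([o∸n]+[n∸m]≡o∸m j≤i i≤D)) ⟩
    dehnSommervilleTerm k (i ℕ.∸ j) ∎
    where
    D = suc d
    k = D ℕ.∸ i
    j≤D = ℕP.≤-trans j≤i i≤D
    binomial-symmetry : (D ℕ.∸ j) C (i ℕ.∸ j) ≡ (D ℕ.∸ j) C k
    binomial-symmetry = begin
      (D ℕ.∸ j) C (i ℕ.∸ j)                ≡⟨ cong ((D ℕ.∸ j) C_) ([o∸m]∸[o∸n]≡n∸m j≤i i≤D) ⟨
      (D ℕ.∸ j) C ((D ℕ.∸ j) ℕ.∸ k)        ≡⟨ nCk≡nC[n∸k] (ℕP.∸-monoʳ-≤ D j≤i) ⟨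
      (D ℕ.∸ j) C k                         ∎

  rowSum-≤ : ∀ {i} → i ≤ suc d → rowSum i ≡ dehnSommervilleSum (suc d ℕ.∸ i)
  rowSum-≤ {i} i≤D = begin
    rowSum i                                  ≡⟨ sumTo-cong (suc i) (λ j j<1+i → rowSum-term (≤-pred j<1+i) i≤D) ⟩
    sumTo (suc i) (λ j → dehnSommervilleTerm k (i ℕ.∸ j))
                                              ≡⟨ sumTo-reverse (suc i) (dehnSommervilleTerm k) ⟨
    sumTo (suc i) (dehnSommervilleTerm k)     ≡⟨ cong (λ l → sumTo l (dehnSommervilleTerm k)) range ⟨
    dehnSommervilleSum k                      ∎
    where
    k = suc d ℕ.∸ i
    range : suc (suc d) ℕ.∸ k ≡ suc i
    range = trans (ℕP.+-∸-assoc 1 (ℕP.m∸n≤m (suc d) i)) (cong suc (ℕP.m∸[m∸n]≡n i≤D))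

  rowSum-> : ∀ {i} → suc d < i → rowSum i ≡ + 0
  rowSum-> {i} D<i = sumTo-≡0 (suc i) λ j j<1+i → vanishing (≤-pred j<1+i)
    where
    vanishing : ∀ {j} → j ≤ i → Tds d i j * fvec F d j ≡ + 0
    vanishing {j} j≤i with j ≤? suc d
    ... | yes j≤D = begin
      Tds d i j * fvec F d j
        ≡⟨ cong (_* fvec F d j) (Tds-entry d j≤i j≤D) ⟩
      sgn j * + ((suc d ℕ.∸ j) C (i ℕ.∸ j)) * fvec F d j
        ≡⟨ cong (λ c → sgn j * + c * fvec F d j) (k>n⇒nCk≡0 (ℕP.∸-monoˡ-< D<i j≤D)) ⟩
      sgn j * + 0 * fvec F d j
        ≡⟨ cong (_* fvec F d j) (ℤP.*-zeroʳ (sgn j)) ⟩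
      + 0 ∎
    ... | no j≰D = trans (cong (Tds d i j *_) (fvec-> (≰⇒> j≰D))) (ℤP.*-zeroʳ (Tds d i j))

lemma3p6 : ∀ {n : ℕ} (F : SimplicialComplex n) (d : ℕ) → HasDimension F d →
    (DehnSommerville F d → Eigen1 (Tds d) (fvec F d))
    × (Eigen1 (Tds d) (fvec F d) → DehnSommerville F d)
lemma3p6 F d _ = dehnSommerville⇒eigen , eigen⇒dehnSommerville
  where
  dehnSommerville⇒eigen : DehnSommerville F d → Eigen1 (Tds d) (fvec F d)
  dehnSommerville⇒eigen ds i with i ≤? suc d
  ... | yes i≤D = begin
    rowSum F d i                                ≡⟨ rowSum-≤ F d i≤D ⟩
    dehnSommervilleSum F d (suc d ℕ.∸ i)        ≡⟨ ds (suc d ℕ.∸ i) (ℕP.m∸n≤m (suc d) i) ⟨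
    + fe F (suc d ℕ.∸ i)                        ≡⟨ fvec-≤ F d i≤D ⟨
    fvec F d i                                  ∎
  ... | no i≰D = trans (rowSum-> F d (≰⇒> i≰D)) (sym (fvec-> F d (≰⇒> i≰D)))

  eigen⇒dehnSommerville : Eigen1 (Tds d) (fvec F d) → DehnSommerville F d
  eigen⇒dehnSommerville eigen k k≤D =
    subst (λ l → + fe F l ≡ dehnSommervilleSum F d l) (ℕP.m∸[m∸n]≡n k≤D) (begin
      + fe F (suc d ℕ.∸ i)                      ≡⟨ fvec-≤ F d i≤D ⟨
      fvec F d i                                ≡⟨ eigen i ⟨
      rowSum F d i                              ≡⟨ rowSum-≤ F d i≤D ⟩
      dehnSommervilleSum F d (suc d ℕ.∸ i)      ∎)
    where
    i = suc d ℕ.∸ k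
    i≤D = ℕP.m∸n≤m (suc d) k
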